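{- Let $G$ be a countably infinite abelian group such that the dilation $2\ast G = \{2g : g \in G\}$ is infinite. Let $f : G \to \mathbf{N}_0 \cup \{\infty\}$ be any map such that the set $Z_0 = f^{ -1}(0)$ is a finite subset of $G$. Then there exists a restricted asymptotic basis $B$ of order 2 for $G$ such that $\hat{r}_B(x) = f(x)$ for all $x \in G$.
   Context: $\mathbf{N}_0$ denotes the nonnegative integers. For a subset $B$ of an additive abelian group $G$, the restricted representation function is $\hat{r}_B(x) = \mathrm{card}\{\{b,b'\} \subseteq B : b \neq b' \text{ and } b + b' = x\}$, the number of unordered pairs of distinct elements of $B$ summing to $x$. A set $B \subseteq G$ is a restricted asymptotic basis (of order 2) for $G$ if $\hat{r}_B(x) \geq 1$ for all but finitely many $x \in G$. -}

module Defs where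

open import Level using (Level; _⊔_)
open import Data.Nat using (ℕ)
open import Data.Fin using (Fin)
open import Data.List using (List)
open import Data.List.Relation.Unary.Any using (Any)
open import Data.Product using (Σ; ∃; _×_; _,_; proj₁; proj₂)
open import Data.Sum using (_⊎_)
open import Relation.Nullary using (¬_)
open import Relation.Binary.PropositionalEquality using (_≡_)
open import Relation.Binary.Definitions using (Decidable)
open import Algebra.Bundles using (AbelianGroup)

data ℕ∞ : Set where
  fin : ℕ → ℕ∞
  ∞   : ℕ∞

module _ {c ℓ : Level} (G : AbelianGroup c ℓ) where
  open AbelianGroup G

  _∈ₗ_ : Carrier → List Carrier → Set (c ⊔ ℓ)
  x ∈ₗ L = Any (x ≈_) L

  CountablyInfinite : Set (c ⊔ ℓ)
  CountablyInfinite =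
    Σ (ℕ → Carrier) λ e →
      (∀ m n → e m ≈ e n → m ≡ n) × (∀ x → ∃ λ n → e n ≈ x)

  InDilation2 : Carrier → Set (c ⊔ ℓ)
  InDilation2 y = ∃ λ g → (g ∙ g) ≈ y

  Dilation2Infinite : Set (c ⊔ ℓ)
  Dilation2Infinite = ∀ (L : List Carrier) → ∃ λ y → InDilation2 y × ¬ (y ∈ₗ L)

  RespectsEq : ∀ {p} → (Carrier → Set p) → Set (c ⊔ ℓ ⊔ p)
  RespectsEq B = ∀ {x y} → x ≈ y → B x → B y

  Rep : ∀ {p} → (Carrier → Set p) → Carrier → Set (c ⊔ ℓ ⊔ p)
  Rep B x = Σ (Carrier × Carrier) λ { (b , b') →
              B b × B b' × ¬ (b ≈ b') × ((b ∙ b') ≈ x) }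

  SamePair : ∀ {p} {B : Carrier → Set p} {x : Carrier} →
             Rep B x → Rep B x → Set ℓ
  SamePair ((a , b) , _) ((a' , b') , _) =
    ((a ≈ a') × (b ≈ b')) ⊎ ((a ≈ b') × (b ≈ a'))

  -- card {{b,b'} ⊆ B : b ≠ b', b + b' = x} = n
  HasFinCard : ∀ {p} → (Carrier → Set p) → Carrier → ℕ → Set (c ⊔ ℓ ⊔ p)
  HasFinCard B x n =
    Σ (Fin n → Rep B x) λ h →
      (∀ i j → SamePair {B = B} (h i) (h j) → i ≡ j) ×
      (∀ r → ∃ λ i → SamePair {B = B} r (h i))

  HasInfCard : ∀ {p} → (Carrier → Set p) → Carrier → Set (c ⊔ ℓ ⊔ p)
  HasInfCard B x =
    Σ (ℕ → Rep B x) λ h → ∀ m n → SamePair {B = B} (h m) (h n) → m ≡ n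

  RHatEq : ∀ {p} → (Carrier → Set p) → Carrier → ℕ∞ → Set (c ⊔ ℓ ⊔ p)
  RHatEq B x (fin n) = HasFinCard B x n
  RHatEq B x ∞       = HasInfCard B x

  RestrictedAsymptoticBasis : ∀ {p} → (Carrier → Set p) → Set (c ⊔ ℓ ⊔ p)
  RestrictedAsymptoticBasis B =
    ∃ λ (L : List Carrier) → ∀ x → ¬ (x ∈ₗ L) → Rep B x

-- Greedy construction. Enumerate G so that every element is visited infinitely often and grow finite
-- sets B₀ ⊆ B₁ ⊆ ⋯ keeping r̂_{Bₖ} ≤ f. At a visit of x with r̂_{Bₖ}(x) < f(x), add u and x − u, where u is
-- chosen so that u, x − u are new and distinct and the new sums u + b, (x − u) + b (b ∈ Bₖ) are pairwise
-- distinct and avoid x, the sums already realised in Bₖ, and Z₀. Each of these requirements excludes one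
-- value of u or of 2u, so such u exists because 2∗G is infinite. The step raises r̂(x) by one and changes
-- r̂(y), y ≠ x, only from 0 to 1 and only for y ∉ Z₀, where f(y) ≥ 1. Hence r̂ ≤ f is preserved, repeated
-- visits drive r̂_{Bₖ}(x) up to f(x), and B = ⋃ Bₖ satisfies r̂_B = f.

module Submission where

open import Defs
open import Level using (_⊔_)
open import Data.Nat using (ℕ; zero; suc; _+_; _∸_; _≤_; _<_; z≤n; s≤s; _≤?_)
open import Data.Nat.Properties
  using (_≟_; ≤-refl; ≤-trans; ≤-antisym; <-trans; <-cmp; n≤1+n; 1+n≰n; +-suc; +-identityʳ;
         m≤m+n; m≤n+m; m<n+m; <⇒≢; m≤n⇒m<n∨m≡n; m∸n+n≡m; ≮⇒≥)
open import Data.Unit using (⊤; tt)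
open import Data.Fin using (zero; suc)
open import Data.List using (List; []; _∷_; _++_; map; filter; length; lookup; cartesianProductWith)
open import Data.List.Properties
  using (++-assoc; filter-≐; filter-accept; filter-reject; filter-none; filter-++; length-++)
open import Data.List.Relation.Unary.All as All using (All; []; _∷_)
import Data.List.Relation.Unary.All.Properties as All
open import Data.List.Relation.Unary.Any using (here; there)
import Data.List.Relation.Unary.Any as Any
import Data.List.Relation.Unary.Any.Properties as Any
open import Data.List.Relation.Unary.AllPairs using (AllPairs; []; _∷_)
import Data.List.Relation.Unary.AllPairs as AllPairs
import Data.List.Relation.Unary.AllPairs.Properties as AllPairs
import Data.List.Relation.Unary.Unique.Setoid.Properties as UniqueProperties
open import Data.List.Membership.Propositional.Properties using (∈-lookup)
open import Data.Product using (Σ; _×_; _,_; proj₁; proj₂; ∃; ∃₂)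
open import Data.Sum using (_⊎_; inj₁; inj₂)
open import Function using (_∘_)
open import Relation.Nullary using (¬_; Dec; yes; no; contradiction)
import Relation.Unary as U
open import Relation.Binary.Bundles using (Setoid)
open import Relation.Binary.Structures using (IsEquivalence)
open import Relation.Binary.Definitions using (Decidable; tri<; tri≈; tri>)
open import Algebra.Bundles using (AbelianGroup)
import Relation.Binary.PropositionalEquality as ≡
open ≡ using (_≡_)

infix 4 _≼_ _≺_ _≺?_

_≼_ : ℕ → ℕ∞ → Set
n ≼ fin N = n ≤ N
n ≼ ∞     = ⊤

_≺_ : ℕ → ℕ∞ → Set
n ≺ w = suc n ≼ w

_≺?_ : ∀ n w → Dec (n ≺ w)
n ≺? fin N = suc n ≤? N
n ≺? ∞     = yes tt

0≼ : ∀ w → 0 ≼ w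
0≼ (fin _) = z≤n
0≼ ∞       = tt

≺⇒≼ : ∀ {n w} → n ≺ w → n ≼ w
≺⇒≼ {w = fin N} 1+n≤N = ≤-trans (n≤1+n _) 1+n≤N
≺⇒≼ {w = ∞}     _     = tt

≼∧≮⇒≤ : ∀ {m n w} → m ≼ w → ¬ n ≺ w → m ≤ n
≼∧≮⇒≤ {w = fin N} m≤N n≮N = ≤-trans m≤N (≮⇒≥ n≮N)
≼∧≮⇒≤ {w = ∞}     _   n≮∞ = contradiction tt n≮∞

stepwise-<⇒strictlyMonotone : (g : ℕ → ℕ) → (∀ m → g m < g (suc m)) →
                              ∀ {m m′} → m < m′ → g m < g m′
stepwise-<⇒strictlyMonotone g step {m} {suc m′} (s≤s m≤m′) with m≤n⇒m<n∨m≡n m≤m′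
... | inj₁ m<m′   = <-trans (stepwise-<⇒strictlyMonotone g step m<m′) (step m′)
... | inj₂ ≡.refl = step m

module Schedule where

  next : ℕ × ℕ → ℕ × ℕ
  next (i , j) with i ≟ j
  ... | yes _ = 0 , suc j
  ... | no  _ = suc i , j

  -- position runs through (0,0), (0,1), (1,1), (0,2), (1,2), (2,2), …
  position : ℕ → ℕ × ℕ
  position zero    = 0 , 0
  position (suc k) = next (position k)

  triangle : ℕ → ℕ
  triangle zero    = 0
  triangle (suc j) = suc (triangle j + j)

  position-triangle : ∀ j i → i ≤ j → position (triangle j + i) ≡ (i , j)
  position-triangle zero    zero    _ = ≡.refl
  position-triangle (suc j) zero    _
    rewrite +-identityʳ (triangle j + j) | position-triangle j j ≤-refl with j ≟ j
  ... | yes _  = ≡.refl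
  ... | no j≢j = contradiction ≡.refl j≢j
  position-triangle j (suc i) 1+i≤j
    rewrite +-suc (triangle j) i | position-triangle j i (≤-trans (n≤1+n i) 1+i≤j) with i ≟ j
  ... | yes ≡.refl = contradiction 1+i≤j 1+n≰n
  ... | no  _      = ≡.refl

  visit : ℕ → ℕ
  visit = proj₁ ∘ position

  j≤triangle : ∀ j → j ≤ triangle j
  j≤triangle zero    = z≤n
  j≤triangle (suc j) = s≤s (m≤n+m j (triangle j))

  visit-infinitelyOften : ∀ n m → ∃ λ k → m ≤ k × visit k ≡ n
  visit-infinitelyOften n m =
    triangle (m + n) + n ,
    ≤-trans (m≤m+n m n) (≤-trans (j≤triangle (m + n)) (m≤m+n (triangle (m + n)) n)) ,
    ≡.cong proj₁ (position-triangle (m + n) n (m≤n+m n m))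

module _ {a ℓ} (S : Setoid a ℓ) where
  open Setoid S using (_≈_; sym)
  open import Data.List.Relation.Unary.Unique.Setoid S using (Unique)

  lookup-injective : ∀ {xs} → Unique xs → ∀ i j → lookup xs i ≈ lookup xs j → i ≡ j
  lookup-injective (_   ∷ _)  zero    zero    _  = ≡.refl
  lookup-injective (x≉ ∷ _)  zero    (suc j) eq = contradiction eq (All.lookup x≉ (∈-lookup j))
  lookup-injective (x≉ ∷ _)  (suc i) zero    eq = contradiction (sym eq) (All.lookup x≉ (∈-lookup i))
  lookup-injective (_   ∷ u) (suc i) (suc j) eq = ≡.cong suc (lookup-injective u i j eq)

module UnorderedPairs {a ℓ} (S : Setoid a ℓ) where
  open Setoid S renaming (Carrier to A)
  open import Data.List.Membership.Setoid S using (_∈_; _∉_)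
  open import Data.List.Membership.Setoid.Properties using (∈-resp-≈; All[≉]⇒∉)
  open import Data.List.Relation.Unary.Unique.Setoid S using (Unique)

  infix 4 _≈ₚ_

  _≈ₚ_ : A × A → A × A → Set ℓ
  (a , b) ≈ₚ (a′ , b′) = (a ≈ a′ × b ≈ b′) ⊎ (a ≈ b′ × b ≈ a′)

  ≈ₚ-isEquivalence : IsEquivalence _≈ₚ_
  ≈ₚ-isEquivalence = record
    { refl  = inj₁ (refl , refl)
    ; sym   = λ { (inj₁ (p , q)) → inj₁ (sym p , sym q) ; (inj₂ (p , q)) → inj₂ (sym q , sym p) }
    ; trans = ≈ₚ-trans
    }
    where
    ≈ₚ-trans : ∀ {p q r} → p ≈ₚ q → q ≈ₚ r → p ≈ₚ r
    ≈ₚ-trans (inj₁ (p , q)) (inj₁ (r , s)) = inj₁ (trans p r , trans q s)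
    ≈ₚ-trans (inj₁ (p , q)) (inj₂ (r , s)) = inj₂ (trans p r , trans q s)
    ≈ₚ-trans (inj₂ (p , q)) (inj₁ (r , s)) = inj₂ (trans p s , trans q r)
    ≈ₚ-trans (inj₂ (p , q)) (inj₂ (r , s)) = inj₁ (trans p s , trans q r)

  pairSetoid : Setoid a ℓ
  pairSetoid = record { isEquivalence = ≈ₚ-isEquivalence }

  open IsEquivalence ≈ₚ-isEquivalence public using () renaming (sym to ≈ₚ-sym)

  open import Data.List.Membership.Setoid pairSetoid public using () renaming (_∈_ to _∈ₚ_)
  open import Data.List.Relation.Unary.Unique.Setoid pairSetoid public using () renaming (Unique to Uniqueₚ)

  pairs : List A → List (A × A)
  pairs []      = []
  pairs (b ∷ L) = map (b ,_) L ++ pairs L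

  pairs-++ : ∀ X L → ∃ λ Q → pairs (X ++ L) ≡ Q ++ pairs L
  pairs-++ []      L = [] , ≡.refl
  pairs-++ (b ∷ X) L with Q , eq ← pairs-++ X L =
    map (b ,_) (X ++ L) ++ Q ,
    ≡.trans (≡.cong (map (b ,_) (X ++ L) ++_) eq) (≡.sym (++-assoc (map (b ,_) (X ++ L)) Q (pairs L)))

  ∈-pairs⁻ : ∀ L → All (λ p → proj₁ p ∈ L × proj₂ p ∈ L) (pairs L)
  ∈-pairs⁻ []      = []
  ∈-pairs⁻ (b ∷ L) =
    All.++⁺ (All.map⁺ (All.tabulateₛ S (λ c∈L → here refl , there c∈L)))
            (All.map (λ (p∈L , q∈L) → there p∈L , there q∈L) (∈-pairs⁻ L))

  ∈-pairs⁺ : ∀ {b b′} L → ¬ b ≈ b′ → b ∈ L → b′ ∈ L → (b , b′) ∈ₚ pairs L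
  ∈-pairs⁺ (c ∷ L) b≉b′ (here b≈c) (here b′≈c) = contradiction (trans b≈c (sym b′≈c)) b≉b′
  ∈-pairs⁺ (c ∷ L) b≉b′ (here b≈c) (there b′∈L) =
    Any.++⁺ˡ (Any.map⁺ (Any.map (λ b′≈d → inj₁ (b≈c , b′≈d)) b′∈L))
  ∈-pairs⁺ (c ∷ L) b≉b′ (there b∈L) (here b′≈c) =
    Any.++⁺ˡ (Any.map⁺ (Any.map (λ b≈d → inj₂ (b≈d , b′≈c)) b∈L))
  ∈-pairs⁺ (c ∷ L) b≉b′ (there b∈L) (there b′∈L) =
    Any.++⁺ʳ (map (c ,_) L) (∈-pairs⁺ L b≉b′ b∈L b′∈L)

  pairs-distinct : ∀ {L} → Unique L → All (λ p → ¬ proj₁ p ≈ proj₂ p) (pairs L)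
  pairs-distinct []          = []
  pairs-distinct (b≉ ∷ uniq) = All.++⁺ (All.map⁺ b≉) (pairs-distinct uniq)

  pairs-unique : ∀ {L} → Unique L → Uniqueₚ (pairs L)
  pairs-unique         []                    = []
  pairs-unique {b ∷ L} (b≉ ∷ uniq) =
    AllPairs.++⁺ (AllPairs.map⁺ (AllPairs.map sameHead uniq)) (pairs-unique uniq)
                 (All.map⁺ (All.universal (λ _ → All.map otherHead (∈-pairs⁻ L)) L))
    where
    sameHead : ∀ {c c′} → ¬ c ≈ c′ → ¬ (b , c) ≈ₚ (b , c′)
    sameHead c≉c′ (inj₁ (_ , c≈c′))   = c≉c′ c≈c′
    sameHead c≉c′ (inj₂ (b≈c′ , c≈b)) = c≉c′ (trans c≈b b≈c′)
    b∉L : b ∉ L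
    b∉L = All[≉]⇒∉ S b≉
    otherHead : ∀ {c q} → proj₁ q ∈ L × proj₂ q ∈ L → ¬ (b , c) ≈ₚ q
    otherHead (q₁∈L , _) (inj₁ (b≈q₁ , _)) = b∉L (∈-resp-≈ S (sym b≈q₁) q₁∈L)
    otherHead (_ , q₂∈L) (inj₂ (b≈q₂ , _)) = b∉L (∈-resp-≈ S (sym b≈q₂) q₂∈L)

module Representations {c ℓ} (G : AbelianGroup c ℓ) (_≟_ : Decidable (AbelianGroup._≈_ G)) where
  open AbelianGroup G renaming (Carrier to C)
  open UnorderedPairs setoid public
  open import Data.List.Membership.Setoid setoid using (_∈_; _∉_)
  open import Data.List.Membership.Setoid.Properties using (∈-length; ∈-++⁻; ∈-filter⁺)
  open import Data.List.Relation.Unary.Unique.Setoid setoid using (Unique)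

  pairSum : C × C → C
  pairSum (a , b) = a ∙ b

  pairSum-cong : ∀ {p q} → p ≈ₚ q → pairSum p ≈ pairSum q
  pairSum-cong (inj₁ (a≈a′ , b≈b′)) = ∙-cong a≈a′ b≈b′
  pairSum-cong (inj₂ (a≈b′ , b≈a′)) = trans (∙-cong a≈b′ b≈a′) (comm _ _)

  sums : List C → List C
  sums L = map pairSum (pairs L)

  sumsTo? : ∀ y → U.Decidable (λ p → pairSum p ≈ y)
  sumsTo? y p = pairSum p ≟ y

  representations : C → List C → List (C × C)
  representations y L = filter (sumsTo? y) (pairs L)

  r̂ : List C → C → ℕ
  r̂ L y = length (representations y L)

  r̂-cong : ∀ L {y y′} → y ≈ y′ → r̂ L y ≡ r̂ L y′
  r̂-cong L y≈y′ =
    ≡.cong length (filter-≐ _ _ ((λ s≈y → trans s≈y y≈y′) , (λ s≈y′ → trans s≈y′ (sym y≈y′))) (pairs L))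

  r̂-≡0 : ∀ L {y} → y ∉ sums L → r̂ L y ≡ 0
  r̂-≡0 L y∉ =
    ≡.cong length (filter-none _ (All.¬Any⇒All¬ _ (λ s≈y → y∉ (Any.map⁺ (Any.map sym s≈y)))))

  representations-++ : ∀ y X L → ∃ λ Q → representations y (X ++ L) ≡ Q ++ representations y L
  representations-++ y X L with Q , eq ← pairs-++ X L =
    filter _ Q , ≡.trans (≡.cong (filter _) eq) (filter-++ _ Q (pairs L))

  r̂-++-mono : ∀ y X L → r̂ L y ≤ r̂ (X ++ L) y
  r̂-++-mono y X L with Q , eq ← representations-++ y X L
    rewrite eq | length-++ Q {representations y L} = m≤n+m _ _

  ∈-representations-stable : ∀ {y p} X L → r̂ (X ++ L) y ≡ r̂ L y →
                             p ∈ₚ representations y (X ++ L) → p ∈ₚ representations y L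
  ∈-representations-stable {y} X L same p∈ with Q , eq ← representations-++ y X L
    rewrite eq | length-++ Q {representations y L} with ∈-++⁻ pairSetoid Q p∈
  ... | inj₂ p∈R = p∈R
  ... | inj₁ p∈Q = contradiction (≡.sym same) (<⇒≢ (m<n+m (r̂ L y) (∈-length pairSetoid p∈Q)))

  IsRep : ∀ {p} → (C → Set p) → C → C × C → Set (ℓ ⊔ p)
  IsRep B y (b , b′) = B b × B b′ × ¬ b ≈ b′ × b ∙ b′ ≈ y

  representations-IsRep : ∀ {p} {B : C → Set p} {y} L → Unique L → (∀ {b} → b ∈ L → B b) →
                          All (IsRep B y) (representations y L)
  representations-IsRep L uniq L⊆B =
    All.map (λ (((b∈L , b′∈L) , b≉b′) , s≈y) → L⊆B b∈L , L⊆B b′∈L , b≉b′ , s≈y)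
      (All.zip (All.filter⁺ _ (All.zip (∈-pairs⁻ L , pairs-distinct uniq)) , All.all-filter _ (pairs L)))

  HasFinCard-fromList : ∀ {p} {B : C → Set p} {y} R → All (IsRep B y) R → Uniqueₚ R →
                        (∀ (r : Rep G B y) → proj₁ r ∈ₚ R) → HasFinCard G B y (length R)
  HasFinCard-fromList R reps uniq complete =
    (λ i → lookup R i , All.lookup reps (∈-lookup i)) ,
    lookup-injective pairSetoid uniq ,
    λ r → Any.index (complete r) , Any.lookup-index (complete r)

  ∈-representations⁺ : ∀ {y b b′} L → b ∈ L → b′ ∈ L → ¬ b ≈ b′ → b ∙ b′ ≈ y →
                       (b , b′) ∈ₚ representations y L
  ∈-representations⁺ {y} L b∈L b′∈L b≉b′ =
    ∈-filter⁺ pairSetoid (sumsTo? y) (λ p≈q s≈y → trans (sym (pairSum-cong p≈q)) s≈y)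
      (∈-pairs⁺ L b≉b′ b∈L b′∈L)

  RHatEq⇒Rep : ∀ {p} {B : C → Set p} {y w} → RHatEq G B y w → ¬ w ≡ fin 0 → Rep G B y
  RHatEq⇒Rep {w = fin zero}    _       w≢0 = contradiction ≡.refl w≢0
  RHatEq⇒Rep {w = fin (suc _)} (h , _) _   = h zero
  RHatEq⇒Rep {w = ∞}           (h , _) _   = h 0

module _ {c ℓ} (G : AbelianGroup c ℓ) where
  open AbelianGroup G renaming (Carrier to C)
  open import Data.List.Membership.Setoid setoid using (_∈_; _∉_)
  open import Data.List.Membership.Setoid.Properties using (∈-resp-≈; ∈-map⁺; ∈-++⁺ˡ; ∈-++⁺ʳ)

  doubling-avoids : Dilation2Infinite G → ∀ T U → ∃ λ u → u ∙ u ∉ T × u ∉ U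
  doubling-avoids dil T U with y , (u , u∙u≈y) , y∉ ← dil (T ++ map (λ w → w ∙ w) U) =
    u ,
    (λ u∙u∈T → y∉ (∈-++⁺ˡ setoid (∈-resp-≈ setoid u∙u≈y u∙u∈T))) ,
    (λ u∈U → y∉ (∈-++⁺ʳ setoid T
      (∈-resp-≈ setoid u∙u≈y (∈-map⁺ setoid setoid (λ w≈w′ → ∙-cong w≈w′ w≈w′) u∈U))))

module Extension {c ℓ} (G : AbelianGroup c ℓ) (_≟_ : Decidable (AbelianGroup._≈_ G))
                 (Z : List (AbelianGroup.Carrier G)) where
  open AbelianGroup G renaming (Carrier to C)
  open Representations G _≟_
  open import Algebra.Properties.AbelianGroup G using (x≈z//y; //-rightDividesˡ; //-cong₂; ∙-cancelˡ)
  open import Data.List.Membership.Setoid setoid using (_∈_; _∉_)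
  open import Data.List.Membership.Setoid.Properties using (∈-++⁺ˡ; ∈-++⁺ʳ)
  open import Data.List.Relation.Unary.Unique.Setoid setoid using (Unique)

  forbidden : C → List C → List C
  forbidden x L = x ∷ sums L ++ Z

  record Admissible (x : C) (L : List C) (u : C) : Set (c ⊔ ℓ) where
    field
      u∉L         : u ∉ L
      x-u∉L       : x - u ∉ L
      u≉x-u       : ¬ u ≈ x - u
      u∙L∉forbidden   : ∀ {b} → b ∈ L → u ∙ b ∉ forbidden x L
      x-u∙L∉forbidden : ∀ {b} → b ∈ L → (x - u) ∙ b ∉ forbidden x L
      u∙L≉x-u∙L   : ∀ {b b′} → b ∈ L → b′ ∈ L → ¬ u ∙ b ≈ (x - u) ∙ b′

  admissible : Dilation2Infinite G → ∀ x L → ∃ (Admissible x L)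
  admissible dil x L = u , record
    { u∉L             = u∉U ∘ ∈-++⁺ˡ setoid
    ; x-u∉L           = λ v∈L → u∉U₁ (Any.map⁺ (Any.map u≈x-b v∈L))
    ; u≉x-u           = λ u≈v → u∙u∉T (here (trans (∙-congˡ u≈v) u∙v≈x))
    ; u∙L∉forbidden   = λ b∈L u∙b∈F → u∉U₂ (Any.cartesianProductWith⁺ _ u≈s-b u∙b∈F b∈L)
    ; x-u∙L∉forbidden = λ b∈L v∙b∈F → u∉U₃ (Any.cartesianProductWith⁺ _ u≈[x∙b]-s v∙b∈F b∈L)
    ; u∙L≉x-u∙L       = λ b∈L b′∈L u∙b≈v∙b′ →
                          u∙u∉T (there (Any.cartesianProductWith⁺ _ (u∙u≈[x∙b′]-b u∙b≈v∙b′) b∈L b′∈L))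
    }
    where
    F U₁ U₂ U₃ U T : List C
    F  = forbidden x L
    U₁ = map (x -_) L
    U₂ = cartesianProductWith _-_ F L
    U₃ = cartesianProductWith (λ s b → (x ∙ b) - s) F L
    U  = L ++ U₁ ++ U₂ ++ U₃
    T  = x ∷ cartesianProductWith (λ b b′ → (x ∙ b′) - b) L L

    u : C
    u = proj₁ (doubling-avoids G dil T U)
    u∙u∉T : u ∙ u ∉ T
    u∙u∉T = proj₁ (proj₂ (doubling-avoids G dil T U))
    u∉U : u ∉ U
    u∉U = proj₂ (proj₂ (doubling-avoids G dil T U))
    u∉U₁ : u ∉ U₁
    u∉U₁ = u∉U ∘ ∈-++⁺ʳ setoid L ∘ ∈-++⁺ˡ setoid
    u∉U₂ : u ∉ U₂
    u∉U₂ = u∉U ∘ ∈-++⁺ʳ setoid L ∘ ∈-++⁺ʳ setoid U₁ ∘ ∈-++⁺ˡ setoid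
    u∉U₃ : u ∉ U₃
    u∉U₃ = u∉U ∘ ∈-++⁺ʳ setoid L ∘ ∈-++⁺ʳ setoid U₁ ∘ ∈-++⁺ʳ setoid U₂

    v : C
    v = x - u
    u∙v≈x : u ∙ v ≈ x
    u∙v≈x = trans (comm u v) (//-rightDividesˡ u x)
    u∙[v∙b]≈x∙b : ∀ b → u ∙ (v ∙ b) ≈ x ∙ b
    u∙[v∙b]≈x∙b b = trans (sym (assoc u v b)) (∙-congʳ u∙v≈x)

    u≈x-b : ∀ {b} → v ≈ b → u ≈ x - b
    u≈x-b v≈b = x≈z//y u _ x (trans (∙-congˡ (sym v≈b)) u∙v≈x)
    u≈s-b : ∀ {b s c} → u ∙ b ≈ s → b ≈ c → u ≈ s - c
    u≈s-b u∙b≈s b≈c = trans (x≈z//y u _ _ u∙b≈s) (//-cong₂ refl b≈c)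
    u≈[x∙b]-s : ∀ {b s c} → v ∙ b ≈ s → b ≈ c → u ≈ (x ∙ c) - s
    u≈[x∙b]-s {b} v∙b≈s b≈c =
      trans (x≈z//y u _ _ (trans (∙-congˡ (sym v∙b≈s)) (u∙[v∙b]≈x∙b b))) (//-cong₂ (∙-congˡ b≈c) refl)
    u∙u≈[x∙b′]-b : ∀ {b b′ c c′} → u ∙ b ≈ v ∙ b′ → b ≈ c → b′ ≈ c′ → u ∙ u ≈ (x ∙ c′) - c
    u∙u≈[x∙b′]-b {b} {b′} u∙b≈v∙b′ b≈c b′≈c′ =
      trans (x≈z//y (u ∙ u) b _ (trans (assoc u u b) (trans (∙-congˡ u∙b≈v∙b′) (u∙[v∙b]≈x∙b b′))))
            (//-cong₂ (∙-congˡ b′≈c′) b≈c)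

  module Extend {x L u} (uniq : Unique L) (adm : Admissible x L u) where
    open Admissible adm
    open import Data.List.Membership.Setoid.Properties using (∉⇒All[≉]; ∈-resp-≈)

    v : C
    v = x - u

    extended-unique : Unique (v ∷ u ∷ L)
    extended-unique =
      ((λ v≈u → u≉x-u (sym v≈u)) ∷ ∉⇒All[≉] setoid x-u∉L) ∷ ∉⇒All[≉] setoid u∉L ∷ uniq

    side : List (C × C)
    side = map (v ,_) L ++ map (u ,_) L

    newPairs : List (C × C)
    newPairs = (v , u) ∷ side

    pairs-extended : pairs (v ∷ u ∷ L) ≡ newPairs ++ pairs L
    pairs-extended = ≡.cong ((v , u) ∷_) (≡.sym (++-assoc (map (v ,_) L) (map (u ,_) L) (pairs L)))

    side-∉forbidden : All (λ p → pairSum p ∉ forbidden x L) side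
    side-∉forbidden = All.++⁺ (All.map⁺ (All.tabulateₛ setoid x-u∙L∉forbidden))
                              (All.map⁺ (All.tabulateₛ setoid u∙L∉forbidden))

    side-distinctSums : AllPairs (λ p q → ¬ pairSum p ≈ pairSum q) side
    side-distinctSums =
      AllPairs.++⁺ (AllPairs.map⁺ (AllPairs.map (λ b≉b′ → b≉b′ ∘ ∙-cancelˡ v _ _) uniq))
                   (AllPairs.map⁺ (AllPairs.map (λ b≉b′ → b≉b′ ∘ ∙-cancelˡ u _ _) uniq))
                   (All.map⁺ (All.tabulateₛ setoid λ b∈L →
                     All.map⁺ (All.tabulateₛ setoid λ b′∈L v∙b≈u∙b′ →
                       u∙L≉x-u∙L b′∈L b∈L (sym v∙b≈u∙b′))))

    side-representations : ∀ y → filter (sumsTo? y) side ≡ [] ⊎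
                                 (length (filter (sumsTo? y) side) ≡ 1 × y ∉ forbidden x L)
    side-representations y
      with filter (sumsTo? y) side | All.all-filter (sumsTo? y) side
         | All.filter⁺ (sumsTo? y) side-∉forbidden | AllPairs.filter⁺ (sumsTo? y) side-distinctSums
    ... | []        | _              | _        | _              = inj₁ ≡.refl
    ... | _ ∷ []    | s≈y ∷ []       | s∉F ∷ [] | _              = inj₂ (≡.refl , s∉F ∘ ∈-resp-≈ setoid (sym s≈y))
    ... | _ ∷ _ ∷ _ | s≈y ∷ s′≈y ∷ _ | _        | (s≉s′ ∷ _) ∷ _ = contradiction (trans s≈y (sym s′≈y)) s≉s′

    r̂-extended : ∀ y → r̂ (v ∷ u ∷ L) y ≡ length (filter (sumsTo? y) newPairs) + r̂ L y
    r̂-extended y = begin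
      length (filter P (pairs (v ∷ u ∷ L)))               ≡⟨ ≡.cong (length ∘ filter P) pairs-extended ⟩
      length (filter P (newPairs ++ pairs L))             ≡⟨ ≡.cong length (filter-++ P newPairs (pairs L)) ⟩
      length (filter P newPairs ++ representations y L)   ≡⟨ length-++ (filter P newPairs) ⟩
      length (filter P newPairs) + r̂ L y                  ∎
      where
      open ≡.≡-Reasoning
      P = sumsTo? y

    r̂-extend-≈ : ∀ {y} → x ≈ y → r̂ (v ∷ u ∷ L) y ≡ suc (r̂ L y)
    r̂-extend-≈ {y} x≈y = ≡.trans (r̂-extended y) (≡.cong (λ R → length R + r̂ L y) newPairs-filter)
      where
      newPairs-filter : filter (sumsTo? y) newPairs ≡ (v , u) ∷ []
      newPairs-filter = ≡.trans (filter-accept (sumsTo? y) (trans (//-rightDividesˡ u x) x≈y))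
        (≡.cong ((v , u) ∷_) (filter-none (sumsTo? y)
          (All.map (λ s∉F s≈y → s∉F (here (trans s≈y (sym x≈y)))) side-∉forbidden)))

    r̂-extend-side : ∀ {y} → ¬ x ≈ y → r̂ (v ∷ u ∷ L) y ≡ length (filter (sumsTo? y) side) + r̂ L y
    r̂-extend-side {y} x≉y = ≡.trans (r̂-extended y) (≡.cong (λ R → length R + r̂ L y)
      (filter-reject (sumsTo? y) (x≉y ∘ trans (sym (//-rightDividesˡ u x)))))

    r̂-extend-≉ : ∀ {y} → ¬ x ≈ y → r̂ (v ∷ u ∷ L) y ≡ r̂ L y ⊎ (r̂ (v ∷ u ∷ L) y ≡ 1 × y ∉ Z)
    r̂-extend-≉ {y} x≉y with side-representations y
    ... | inj₁ none        = inj₁ (≡.trans (r̂-extend-side x≉y) (≡.cong (λ R → length R + r̂ L y) none))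
    ... | inj₂ (one , y∉F) =
      inj₂ (≡.trans (r̂-extend-side x≉y) (≡.cong₂ _+_ one (r̂-≡0 L (y∉F ∘ there ∘ ∈-++⁺ˡ setoid))) ,
            y∉F ∘ there ∘ ∈-++⁺ʳ setoid (sums L))

module Greedy {c ℓ} (G : AbelianGroup c ℓ) (_≟_ : Decidable (AbelianGroup._≈_ G))
  (dil : Dilation2Infinite G)
  (f : AbelianGroup.Carrier G → ℕ∞) (f-cong : ∀ {x y} → AbelianGroup._≈_ G x y → f x ≡ f y)
  (Z₀ : List (AbelianGroup.Carrier G)) (Z₀-complete : ∀ x → f x ≡ fin 0 → _∈ₗ_ G x Z₀)
  (xs : ℕ → AbelianGroup.Carrier G) (visits : ∀ y m → ∃ λ k → m ≤ k × AbelianGroup._≈_ G (xs k) y)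
  where
  open AbelianGroup G renaming (Carrier to C)
  open Representations G _≟_
  open Extension G _≟_ Z₀
  open import Algebra.Properties.AbelianGroup G using (//-rightDividesˡ)
  open import Data.List.Membership.Setoid setoid using (_∈_; _∉_)
  open import Data.List.Membership.Setoid.Properties using (∈-resp-≈; ∈-++⁺ʳ)
  open import Data.List.Relation.Unary.Unique.Setoid setoid using (Unique)

  Bounded : List C → Set c
  Bounded L = ∀ y → r̂ L y ≼ f y

  chosen : C → List C → C
  chosen x L = proj₁ (admissible dil x L)

  step : C → List C → List C
  step x L with r̂ L x ≺? f x
  ... | yes _ = x - chosen x L ∷ chosen x L ∷ L
  ... | no  _ = L

  step-++ : ∀ x L → ∃ λ X → step x L ≡ X ++ L
  step-++ x L with r̂ L x ≺? f x
  ... | yes _ = _ , ≡.refl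
  ... | no  _ = [] , ≡.refl

  step-unique : ∀ {x L} → Unique L → Unique (step x L)
  step-unique {x} {L} uniq with r̂ L x ≺? f x
  ... | yes _ = Extend.extended-unique uniq (proj₂ (admissible dil x L))
  ... | no  _ = uniq

  1≼f : ∀ {y} → y ∉ Z₀ → 1 ≼ f y
  1≼f {y} y∉Z₀ with f y in fy
  ... | fin zero    = contradiction (Z₀-complete y fy) y∉Z₀
  ... | fin (suc _) = s≤s z≤n
  ... | ∞           = tt

  step-bounded : ∀ {x L} → Unique L → Bounded L → Bounded (step x L)
  step-bounded {x} {L} uniq bounded y with r̂ L x ≺? f x
  ... | no  _ = bounded y
  ... | yes r̂<f with x ≟ y
  ...   | yes x≈y =
    ≡.subst (_≼ f y) (≡.sym (Extend.r̂-extend-≈ uniq (proj₂ (admissible dil x L)) x≈y))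
      (≡.subst₂ _≺_ (r̂-cong L x≈y) (f-cong x≈y) r̂<f)
  ...   | no x≉y with Extend.r̂-extend-≉ uniq (proj₂ (admissible dil x L)) x≉y
  ...     | inj₁ same          = ≡.subst (_≼ f y) (≡.sym same) (bounded y)
  ...     | inj₂ (one , y∉Z₀) = ≡.subst (_≼ f y) (≡.sym one) (1≼f y∉Z₀)

  step-grows : ∀ {x L y} → Unique L → x ≈ y → r̂ L y ≺ f y → r̂ (step x L) y ≡ suc (r̂ L y)
  step-grows {x} {L} {y} uniq x≈y r̂<f with r̂ L x ≺? f x
  ... | yes _    = Extend.r̂-extend-≈ uniq (proj₂ (admissible dil x L)) x≈y
  ... | no  r̂≮f = contradiction (≡.subst₂ _≺_ (≡.sym (r̂-cong L x≈y)) (≡.sym (f-cong x≈y)) r̂<f) r̂≮f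

  AddsPair : C → List C → List C → Set (c ⊔ ℓ)
  AddsPair x L L′ = ∃₂ λ a b → L′ ≡ a ∷ b ∷ L × a ∉ L × b ∉ L × ¬ a ≈ b × a ∙ b ≈ x

  step-addsPair : ∀ {x L} → r̂ L x ≺ f x → AddsPair x L (step x L)
  step-addsPair {x} {L} r̂<f with r̂ L x ≺? f x
  ... | no  r̂≮f = contradiction r̂<f r̂≮f
  ... | yes _    =
    _ , _ , ≡.refl , x-u∉L , u∉L , (λ v≈u → u≉x-u (sym v≈u)) , //-rightDividesˡ (chosen x L) x
    where open Admissible (proj₂ (admissible dil x L))

  stage : ℕ → List C
  stage zero    = []
  stage (suc k) = step (xs k) (stage k)

  stage-unique : ∀ k → Unique (stage k)
  stage-unique zero    = []
  stage-unique (suc k) = step-unique (stage-unique k)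

  stage-bounded : ∀ k → Bounded (stage k)
  stage-bounded zero    y = 0≼ (f y)
  stage-bounded (suc k)   = step-bounded (stage-unique k) (stage-bounded k)

  stage-++ : ∀ {k k′} → k ≤ k′ → ∃ λ X → stage k′ ≡ X ++ stage k
  stage-++ {k} {k′} k≤k′ =
    ≡.subst (λ k′ → ∃ λ X → stage k′ ≡ X ++ stage k) (m∸n+n≡m k≤k′) (go (k′ ∸ k))
    where
    go : ∀ d → ∃ λ X → stage (d + k) ≡ X ++ stage k
    go zero    = [] , ≡.refl
    go (suc d) with X , eq ← go d | Y , eq′ ← step-++ (xs (d + k)) (stage (d + k)) =
      Y ++ X , ≡.trans eq′ (≡.trans (≡.cong (Y ++_) eq) (≡.sym (++-assoc Y X (stage k))))

  stage-mono-∈ : ∀ {k k′ y} → k ≤ k′ → y ∈ stage k → y ∈ stage k′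
  stage-mono-∈ {y = y} k≤k′ y∈ with X , eq ← stage-++ k≤k′ =
    ≡.subst (y ∈_) (≡.sym eq) (∈-++⁺ʳ setoid X y∈)

  stage-mono-r̂ : ∀ {k k′} y → k ≤ k′ → r̂ (stage k) y ≤ r̂ (stage k′) y
  stage-mono-r̂ {k} y k≤k′ with X , eq ← stage-++ k≤k′ =
    ≡.subst (λ L → r̂ (stage k) y ≤ r̂ L y) (≡.sym eq) (r̂-++-mono y X (stage k))

  B : C → Set (c ⊔ ℓ)
  B y = ∃ λ k → y ∈ stage k

  B-resp : RespectsEq G B
  B-resp x≈y (k , x∈) = k , ∈-resp-≈ setoid x≈y x∈

  grows-at-visit : ∀ {y k t} → xs k ≈ y → t ≤ r̂ (stage k) y → suc t ≼ f y → suc t ≤ r̂ (stage (suc k)) y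
  grows-at-visit {y} {k} {t} xk≈y t≤r̂ 1+t≼f with r̂ (stage k) y ≺? f y
  ... | yes r̂<f = ≡.subst (suc t ≤_) (≡.sym (step-grows (stage-unique k) xk≈y r̂<f)) (s≤s t≤r̂)
  ... | no  r̂≮f = ≤-trans (≼∧≮⇒≤ 1+t≼f r̂≮f) (stage-mono-r̂ y (n≤1+n k))

  reaches : ∀ y t → t ≼ f y → ∃ λ K → t ≤ r̂ (stage K) y
  reaches y zero    _     = 0 , z≤n
  reaches y (suc t) 1+t≼f =
    let K , t≤r̂      = reaches y t (≺⇒≼ 1+t≼f)
        k , K≤k , xk≈y = visits y K
    in suc k , grows-at-visit xk≈y (≤-trans t≤r̂ (stage-mono-r̂ y K≤k)) 1+t≼f

  representations-stabilise : ∀ {y K} → (∀ {k} → K ≤ k → r̂ (stage k) y ≡ r̂ (stage K) y) →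
                              ∀ (r : Rep G B y) → proj₁ r ∈ₚ representations y (stage K)
  representations-stabilise {y} {K} stable ((b , b′) , (k₁ , b∈) , (k₂ , b′∈) , b≉b′ , s≈y)
    = let X , eq = stage-++ K≤k in
    ∈-representations-stable X (stage K) (≡.subst (λ L → r̂ L y ≡ r̂ (stage K) y) eq (stable K≤k))
      (≡.subst (λ L → (b , b′) ∈ₚ representations y L) eq
        (∈-representations⁺ (stage k) (stage-mono-∈ k₁≤k b∈) (stage-mono-∈ k₂≤k b′∈) b≉b′ s≈y))
    where
    k = K + (k₁ + k₂)
    K≤k : K ≤ k
    K≤k = m≤m+n K _
    k₁≤k : k₁ ≤ k
    k₁≤k = ≤-trans (m≤m+n k₁ k₂) (m≤n+m _ K)
    k₂≤k : k₂ ≤ k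
    k₂≤k = ≤-trans (m≤n+m k₂ k₁) (m≤n+m _ K)

  hasFinCard : ∀ y {N} → f y ≡ fin N → HasFinCard G B y N
  hasFinCard y {N} fy≡N =
    ≡.subst (HasFinCard G B y) r̂K≡N
      (HasFinCard-fromList (representations y (stage K))
        (representations-IsRep (stage K) (stage-unique K) (K ,_))
        (UniqueProperties.filter⁺ pairSetoid (sumsTo? y) (pairs-unique (stage-unique K)))
        (representations-stabilise stable))
    where
    r̂≤N : ∀ k → r̂ (stage k) y ≤ N
    r̂≤N k = ≡.subst (r̂ (stage k) y ≼_) fy≡N (stage-bounded k y)
    reachesN : ∃ λ K → N ≤ r̂ (stage K) y
    reachesN = reaches y N (≡.subst (N ≼_) (≡.sym fy≡N) ≤-refl)
    K : ℕ
    K = proj₁ reachesN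
    r̂K≡N : r̂ (stage K) y ≡ N
    r̂K≡N = ≤-antisym (r̂≤N K) (proj₂ reachesN)
    stable : ∀ {k} → K ≤ k → r̂ (stage k) y ≡ r̂ (stage K) y
    stable {k} K≤k = ≤-antisym (≡.subst (_ ≤_) (≡.sym r̂K≡N) (r̂≤N k)) (stage-mono-r̂ y K≤k)

  hasInfCard : ∀ y → f y ≡ ∞ → HasInfCard G B y
  hasInfCard y fy≡∞ = rep , rep-injective
    where
    time : ℕ → ℕ
    time zero    = proj₁ (visits y 0)
    time (suc m) = proj₁ (visits y (suc (time m)))

    time-< : ∀ m → time m < time (suc m)
    time-< m = proj₁ (proj₂ (visits y (suc (time m))))

    time-visits : ∀ m → xs (time m) ≈ y
    time-visits zero    = proj₂ (proj₂ (visits y 0))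
    time-visits (suc m) = proj₂ (proj₂ (visits y (suc (time m))))

    new : ∀ m → AddsPair (xs (time m)) (stage (time m)) (stage (suc (time m)))
    new m = step-addsPair
      (≡.subst (r̂ (stage (time m)) (xs (time m)) ≺_) (≡.sym (≡.trans (f-cong (time-visits m)) fy≡∞)) tt)

    rep : ℕ → Rep G B y
    rep m =
      let a , b , eq , _ , _ , a≉b , a∙b≈x = new m
      in (a , b) ,
         (suc (time m) , ≡.subst (a ∈_) (≡.sym eq) (here refl)) ,
         (suc (time m) , ≡.subst (b ∈_) (≡.sym eq) (there (here refl))) ,
         a≉b , trans a∙b≈x (time-visits m)

    fresh : ∀ m → proj₁ (proj₁ (rep m)) ∉ stage (time m) × proj₂ (proj₁ (rep m)) ∉ stage (time m)
    fresh m = let _ , _ , _ , a∉ , b∉ , _ = new m in a∉ , b∉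

    persists : ∀ {m m′} → m < m′ → proj₁ (proj₁ (rep m)) ∈ stage (time m′)
    persists {m} m<m′ =
      stage-mono-∈ (stepwise-<⇒strictlyMonotone time time-< m<m′)
        (proj₂ (proj₁ (proj₂ (rep m))))

    older≉newer : ∀ {m m′} → m < m′ → ¬ proj₁ (rep m) ≈ₚ proj₁ (rep m′)
    older≉newer {m′ = m′} m<m′ (inj₁ (a≈a′ , _)) = proj₁ (fresh m′) (∈-resp-≈ setoid a≈a′ (persists m<m′))
    older≉newer {m′ = m′} m<m′ (inj₂ (a≈b′ , _)) = proj₂ (fresh m′) (∈-resp-≈ setoid a≈b′ (persists m<m′))

    rep-injective : ∀ m m′ → SamePair G {B = B} (rep m) (rep m′) → m ≡ m′
    rep-injective m m′ same with <-cmp m m′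
    ... | tri< m<m′ _ _ = contradiction same (older≉newer m<m′)
    ... | tri≈ _ m≡m′ _ = m≡m′
    ... | tri> _ _ m′<m = contradiction (≈ₚ-sym same) (older≉newer m′<m)

  r̂-B : ∀ y → RHatEq G B y (f y)
  r̂-B y with f y in fy
  ... | fin N = hasFinCard y fy
  ... | ∞     = hasInfCard y fy

  basis : RestrictedAsymptoticBasis G B
  basis = Z₀ , λ y y∉Z₀ → RHatEq⇒Rep (r̂-B y) (y∉Z₀ ∘ Z₀-complete y)

theorem2 : ∀ {c ℓ} (G : AbelianGroup c ℓ) →
    Decidable (AbelianGroup._≈_ G) →
    CountablyInfinite G →
    Dilation2Infinite G →
    (f : AbelianGroup.Carrier G → ℕ∞) →
    (∀ {x y} → AbelianGroup._≈_ G x y → f x ≡ f y) →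
    (∃ λ (Z₀ : List (AbelianGroup.Carrier G)) → ∀ x → f x ≡ fin 0 → _∈ₗ_ G x Z₀) →
    Σ (AbelianGroup.Carrier G → Set (c ⊔ ℓ)) λ B →
      RespectsEq G B ×
      RestrictedAsymptoticBasis G B ×
      (∀ x → RHatEq G B x (f x))
theorem2 G _≟_ (e , _ , e-onto) dil f f-cong (Z₀ , Z₀-complete) = B , B-resp , basis , r̂-B
  where
  open AbelianGroup G using (_≈_)
  open Schedule
  -- only surjectivity of the enumeration e is used
  visits : ∀ y m → ∃ λ k → m ≤ k × e (visit k) ≈ y
  visits y m =
    let n , en≈y = e-onto y
        k , m≤k , visit-k≡n = visit-infinitelyOften n m
    in k , m≤k , ≡.subst (λ n → e n ≈ y) (≡.sym visit-k≡n) en≈y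
  open Greedy G _≟_ dil f f-cong Z₀ Z₀-complete (e ∘ visit) visits
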